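{- Let $d,m,n,r$ be positive integers with $n\equiv r\pmod d$, $\gcd(r,d)=1$ and $d\geq m\geq2$. Let $\{\lambda(k)\}_{k=0}^\infty$ be a sequence of complex numbers such that $\lambda(k)=0$ for all integers $k$ with $(n+d-r)/d\leq k\leq n-1$. Then $$\sum_{\substack{k_1,\dots,k_m\geq0\\ k_1+\cdots+k_m\leq n-1}}\lambda(k_1)\lambda(k_2)\cdots\lambda(k_m)=\Bigg\{\sum_{k=0}^{(n-r)/d}\lambda(k)\Bigg\}^m.$$ -}

module Defs where

open import Level using (Level)
open import Data.Nat using (ℕ; zero; suc; _≤?_)
open import Data.List using (List; []; _∷_; map; concatMap; filter; upTo)
open import Data.Vec using (Vec; []; _∷_)
import Data.Vec as Vec
open import Algebra.Bundles using (CommutativeRing)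

tuples : (m B : ℕ) → List (Vec ℕ m)
tuples zero    B = [] ∷ []
tuples (suc m) B = concatMap (λ k → map (k ∷_) (tuples m B)) (upTo (suc B))

module RingSums {c ℓ : Level} (R : CommutativeRing c ℓ) where
  open CommutativeRing R

  Σlist : List Carrier → Carrier
  Σlist []       = 0#
  Σlist (x ∷ xs) = x + Σlist xs

  Πvec : ∀ {m} → (ℕ → Carrier) → Vec ℕ m → Carrier
  Πvec f []       = 1#
  Πvec f (k ∷ ks) = f k * Πvec f ks

  pow : Carrier → ℕ → Carrier
  pow x zero    = 1#
  pow x (suc m) = x * pow x m

  -- Σ over k₁,…,k_m ≥ 0 with k₁+⋯+k_m ≤ B of λ(k₁)⋯λ(k_m)
  -- (each k_i ≤ B automatically, so enumerating tuples with entries ≤ B is exhaustive)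
  tupleSum : (ℕ → Carrier) → (m B : ℕ) → Carrier
  tupleSum f m B =
    Σlist (map (Πvec f) (filter (λ v → Vec.sum v ≤? B) (tuples m B)))

{-# OPTIONS --safe #-}
-- Put q = (n - r)/d, the largest k with d k + r ≤ n (if any).  Since n ≡ r (mod d),
-- every k with d k + r > n even has d k + r ≥ n + d, so λ vanishes on q < k ≤ n - 1.
-- Hence a nonzero term λ(k₁)⋯λ(k_m) has all kᵢ ≤ q, and then k₁ + ⋯ + k_m ≤ m q ≤ d q ≤ n - r < n:
-- the constraint on the sum is automatic, and the left side is the full m-th power of
-- Σ_{k ≤ n-1} λ(k), which equals the right side.
module Submission where

open import Defs
open import Level using (Level)
open import Algebra.Bundles using (CommutativeRing)
open import Data.Nat.Base as ℕ using (ℕ; zero; suc; NonZero; >-nonZero; s≤s⁻¹)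
import Data.Nat.Properties as ℕₚ
open import Data.List using (List; []; _∷_; _++_; [_]; map; concatMap; filter; upTo)
open import Data.List.Properties using (filter-++; filter-reject; ++-identityʳ; upTo-∷ʳ; map-∘)
open import Data.List.Relation.Unary.All as All using (All; []; _∷_)
open import Data.List.Relation.Unary.All.Properties using (applyUpTo⁺₁; concat⁺; map⁺)
open import Data.Vec using (Vec; []; _∷_)
import Data.Vec as Vec
open import Data.Vec.Relation.Unary.All as VecAll using ([]; _∷_)
open import Data.Sum using (_⊎_; inj₁; inj₂)
open import Function.Base using (id; _∘_)
open import Relation.Nullary using (¬_; yes; no; contradiction)
open import Relation.Unary using (Pred; Decidable)
open import Relation.Binary.PropositionalEquality as ≡ using (_≡_; cong; subst; module ≡-Reasoning)
import Relation.Binary.Reasoning.Setoid as SetoidReasoning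

module Arithmetic where
  open import Data.Nat.Base using (_+_; _*_; _∸_; _<_; _≤_; z≤n; ∣_-_∣)
  open import Data.Nat.Properties
  open import Data.Nat.DivMod using (_/_; m*n/n≡m; m/n*n≤m; /-monoˡ-≤)
  open import Data.Nat.Divisibility using (_∣_; ∣⇒≤; ∣m+n∣m⇒∣n; ∣m∣n⇒∣m+n; m∣m*n)
  open import Data.Integer.Base as ℤ using (+_; _-_)
  import Data.Integer.Divisibility as ℤ
  import Data.Integer.Properties as ℤₚ

  ∣+m-+n∣≡∣m-n∣ : ∀ m n → ℤ.∣ + m - + n ∣ ≡ ∣ m - n ∣
  ∣+m-+n∣≡∣m-n∣ m n with ≤-total m n
  ... | inj₁ m≤n = begin
    ℤ.∣ + m - + n ∣  ≡⟨ cong ℤ.∣_∣ (ℤₚ.m-n≡m⊖n m n) ⟩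
    ℤ.∣ m ℤ.⊖ n ∣    ≡⟨ ℤₚ.∣⊖∣-≤ m≤n ⟩
    n ∸ m             ≡⟨ m≤n⇒∣m-n∣≡n∸m m≤n ⟨
    ∣ m - n ∣         ∎
    where open ≡-Reasoning
  ... | inj₂ n≤m = begin
    ℤ.∣ + m - + n ∣  ≡⟨ cong ℤ.∣_∣ (ℤₚ.m-n≡m⊖n m n) ⟩
    ℤ.∣ m ℤ.⊖ n ∣    ≡⟨ ℤₚ.∣m⊖n∣≡∣n⊖m∣ m n ⟩
    ℤ.∣ n ℤ.⊖ m ∣    ≡⟨ ℤₚ.∣⊖∣-≤ n≤m ⟩
    m ∸ n             ≡⟨ m≤n⇒∣n-m∣≡n∸m n≤m ⟨
    ∣ m - n ∣         ∎
    where open ≡-Reasoning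

  -- d k + r and n are congruent mod d, so their positive difference is a multiple of d.
  ∣n-r⇒n<d*k+r⇒n+d≤d*k+r : ∀ {d n r} k → + d ℤ.∣ + n - + r → n < d * k + r → n + d ≤ d * k + r
  ∣n-r⇒n<d*k+r⇒n+d≤d*k+r {d} {n} {r} k d∣n-r n<a = begin
    n + d       ≤⟨ +-monoʳ-≤ n (∣⇒≤ {{>-nonZero (m<n⇒0<n∸m n<a)}} d∣a∸n) ⟩
    n + (a ∸ n) ≡⟨ m+[n∸m]≡n (<⇒≤ n<a) ⟩
    a           ∎
    where
    open ≤-Reasoning
    a : ℕ
    a = d * k + r
    d∣∣n-r∣ : d ∣ ∣ n - r ∣
    d∣∣n-r∣ = subst (d ∣_) (∣+m-+n∣≡∣m-n∣ n r) d∣n-r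
    d∣a∸n : d ∣ a ∸ n
    d∣a∸n with ≤-total r n
    ... | inj₁ r≤n = ∣m+n∣m⇒∣n (subst (d ∣_) (≡.sym n∸r+[a∸n]≡d*k) (m∣m*n k))
                       (subst (d ∣_) (m≤n⇒∣n-m∣≡n∸m r≤n) d∣∣n-r∣)
      where
      n∸r+[a∸n]≡d*k : (n ∸ r) + (a ∸ n) ≡ d * k
      n∸r+[a∸n]≡d*k = begin-equality
        (n ∸ r) + (a ∸ n) ≡⟨ +-∸-assoc (n ∸ r) (<⇒≤ n<a) ⟨
        (n ∸ r) + a ∸ n   ≡⟨ cong (_∸ n) (+-∸-comm a r≤n) ⟨
        n + a ∸ r ∸ n     ≡⟨ ∸-+-assoc (n + a) r n ⟩
        n + a ∸ (r + n)   ≡⟨ cong (n + a ∸_) (+-comm r n) ⟩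
        n + a ∸ (n + r)   ≡⟨ [m+n]∸[m+o]≡n∸o n a r ⟩
        a ∸ r             ≡⟨ m+n∸n≡m (d * k) r ⟩
        d * k             ∎
    ... | inj₂ n≤r = subst (d ∣_) (≡.sym (+-∸-assoc (d * k) n≤r))
                       (∣m∣n⇒∣m+n (m∣m*n k) (subst (d ∣_) (m≤n⇒∣m-n∣≡n∸m n≤r) d∣∣n-r∣))

  m*n≤o⇒n≤o/m : ∀ {m n o} .{{_ : NonZero m}} → m * n ≤ o → n ≤ o / m
  m*n≤o⇒n≤o/m {m} {n} {o} m*n≤o = begin
    n          ≡⟨ m*n/n≡m n m ⟨
    n * m / m  ≤⟨ /-monoˡ-≤ m (subst (_≤ o) (*-comm m n) m*n≤o) ⟩
    o / m      ∎
    where open ≤-Reasoning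

  m≤n⇒m*[o/n]≤o : ∀ {m n} o .{{_ : NonZero n}} → m ≤ n → m * (o / n) ≤ o
  m≤n⇒m*[o/n]≤o {m} {n} o m≤n = begin
    m * (o / n)  ≤⟨ *-monoˡ-≤ (o / n) m≤n ⟩
    n * (o / n)  ≡⟨ *-comm n (o / n) ⟩
    o / n * n    ≤⟨ m/n*n≤m o n ⟩
    o            ∎
    where open ≤-Reasoning

  All≤q⇒sum≤m*q : ∀ {m q} {v : Vec ℕ m} → VecAll.All (_≤ q) v → Vec.sum v ≤ m * q
  All≤q⇒sum≤m*q []            = z≤n
  All≤q⇒sum≤m*q (k≤q ∷ v≤q) = +-mono-≤ k≤q (All≤q⇒sum≤m*q v≤q)

open Arithmetic

tuples-All≤ : ∀ m B → All (VecAll.All (ℕ._≤ B)) (tuples m B)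
tuples-All≤ zero    B = [] ∷ []
tuples-All≤ (suc m) B = concat⁺ (map⁺ (applyUpTo⁺₁ id (suc B) λ k<1+B →
  map⁺ (All.map (s≤s⁻¹ k<1+B ∷_) (tuples-All≤ m B))))

filter-upTo-reject : ∀ {p} {P : Pred ℕ p} (P? : Decidable P) {n} → ¬ P n →
                     filter P? (upTo (suc n)) ≡ filter P? (upTo n)
filter-upTo-reject P? {n} ¬Pn = begin
  filter P? (upTo (suc n))              ≡⟨ cong (filter P?) (upTo-∷ʳ n) ⟨
  filter P? (upTo n ++ [ n ])           ≡⟨ filter-++ P? (upTo n) [ n ] ⟩
  filter P? (upTo n) ++ filter P? [ n ] ≡⟨ cong (filter P? (upTo n) ++_) (filter-reject P? ¬Pn) ⟩
  filter P? (upTo n) ++ []              ≡⟨ ++-identityʳ _ ⟩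
  filter P? (upTo n)                    ∎
  where open ≡-Reasoning

module TupleSums {c ℓ : Level} (R : CommutativeRing c ℓ) where
  open CommutativeRing R
  open RingSums R
  open SetoidReasoning setoid

  pow-cong : ∀ {x y} m → x ≈ y → pow x m ≈ pow y m
  pow-cong zero    x≈y = refl
  pow-cong (suc m) x≈y = *-cong x≈y (pow-cong m x≈y)

  private variable
    a b p : Level
    A : Set a
    B : Set b

  Σ-map-++ : ∀ (g : A → Carrier) xs ys →
             Σlist (map g (xs ++ ys)) ≈ Σlist (map g xs) + Σlist (map g ys)
  Σ-map-++ g []       ys = sym (+-identityˡ _)
  Σ-map-++ g (x ∷ xs) ys = trans (+-congˡ (Σ-map-++ g xs ys)) (sym (+-assoc _ _ _))

  Σ-map-concatMap : ∀ (g : B → Carrier) (h : A → List B) xs →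
                    Σlist (map g (concatMap h xs)) ≈ Σlist (map (λ x → Σlist (map g (h x))) xs)
  Σ-map-concatMap g h []       = refl
  Σ-map-concatMap g h (x ∷ xs) =
    trans (Σ-map-++ g (h x) (concatMap h xs)) (+-congˡ (Σ-map-concatMap g h xs))

  Σ-map-cong : ∀ {g h : A → Carrier} → (∀ x → g x ≈ h x) → ∀ xs →
               Σlist (map g xs) ≈ Σlist (map h xs)
  Σ-map-cong g≈h []       = refl
  Σ-map-cong g≈h (x ∷ xs) = +-cong (g≈h x) (Σ-map-cong g≈h xs)

  Σ-map-*ˡ : ∀ a (g : A → Carrier) xs → Σlist (map (λ x → a * g x) xs) ≈ a * Σlist (map g xs)
  Σ-map-*ˡ a g []       = sym (zeroʳ a)
  Σ-map-*ˡ a g (x ∷ xs) = trans (+-congˡ (Σ-map-*ˡ a g xs)) (sym (distribˡ a _ _))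

  Σ-map-*ʳ : ∀ a (g : A → Carrier) xs → Σlist (map (λ x → g x * a) xs) ≈ Σlist (map g xs) * a
  Σ-map-*ʳ a g []       = sym (zeroˡ a)
  Σ-map-*ʳ a g (x ∷ xs) = trans (+-congˡ (Σ-map-*ʳ a g xs)) (sym (distribʳ a _ _))

  Σ-map-filter : ∀ {P : Pred A p} (P? : Decidable P) {g : A → Carrier} {xs} →
                 All (λ x → ¬ P x → g x ≈ 0#) xs →
                 Σlist (map g (filter P? xs)) ≈ Σlist (map g xs)
  Σ-map-filter P? []                          = refl
  Σ-map-filter P? {g} {x ∷ xs} (gx≈0 ∷ g≈0) with P? x
  ... | yes _  = +-congˡ (Σ-map-filter P? g≈0)
  ... | no ¬Px = begin
    Σlist (map g (filter P? xs)) ≈⟨ Σ-map-filter P? g≈0 ⟩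
    Σlist (map g xs)             ≈⟨ +-identityˡ _ ⟨
    0# + Σlist (map g xs)        ≈⟨ +-congʳ (gx≈0 ¬Px) ⟨
    g x + Σlist (map g xs)       ∎

  Σ-map-filter-upTo : ∀ {P : Pred ℕ p} (P? : Decidable P) {g : ℕ → Carrier} {n} → ¬ P n →
                      (∀ {k} → k ℕ.< n → ¬ P k → g k ≈ 0#) →
                      Σlist (map g (filter P? (upTo (suc n)))) ≈ Σlist (map g (upTo n))
  Σ-map-filter-upTo P? {g} {n} ¬Pn g≈0 = begin
    Σlist (map g (filter P? (upTo (suc n)))) ≡⟨ cong (Σlist ∘ map g) (filter-upTo-reject P? ¬Pn) ⟩
    Σlist (map g (filter P? (upTo n)))       ≈⟨ Σ-map-filter P? (applyUpTo⁺₁ id n g≈0) ⟩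
    Σlist (map g (upTo n))                   ∎

  module _ (f : ℕ → Carrier) where

    Σ-tuples-Πvec : ∀ m B → Σlist (map (Πvec f) (tuples m B)) ≈ pow (Σlist (map f (upTo (suc B)))) m
    Σ-tuples-Πvec zero    B = +-identityʳ 1#
    Σ-tuples-Πvec (suc m) B = begin
      Σlist (map (Πvec f) (concatMap (λ k → map (k ∷_) T) U))
        ≈⟨ Σ-map-concatMap (Πvec f) (λ k → map (k ∷_) T) U ⟩
      Σlist (map (λ k → Σlist (map (Πvec f) (map (k ∷_) T))) U)
        ≈⟨ Σ-map-cong peel U ⟩
      Σlist (map (λ k → f k * Σlist (map (Πvec f) T)) U)
        ≈⟨ Σ-map-*ʳ _ f U ⟩
      Σlist (map f U) * Σlist (map (Πvec f) T)
        ≈⟨ *-congˡ (Σ-tuples-Πvec m B) ⟩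
      Σlist (map f U) * pow (Σlist (map f U)) m
        ∎
      where
      U : List ℕ
      U = upTo (suc B)
      T : List (Vec ℕ m)
      T = tuples m B
      peel : ∀ k → Σlist (map (Πvec f) (map (k ∷_) T)) ≈ f k * Σlist (map (Πvec f) T)
      peel k = trans (reflexive (cong Σlist (≡.sym (map-∘ T)))) (Σ-map-*ˡ (f k) (Πvec f) T)

    module _ {q B : ℕ} (vanish : ∀ k → q ℕ.< k → k ℕ.≤ B → f k ≈ 0#) where

      Πvec≈0⊎All≤ : ∀ {m} {v : Vec ℕ m} → VecAll.All (ℕ._≤ B) v → Πvec f v ≈ 0# ⊎ VecAll.All (ℕ._≤ q) v
      Πvec≈0⊎All≤ []                           = inj₂ []
      Πvec≈0⊎All≤ {v = k ∷ v} (k≤B ∷ v≤B) with k ℕₚ.≤? q | Πvec≈0⊎All≤ v≤B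
      ... | no k≰q | _          = inj₁ (trans (*-congʳ (vanish k (ℕₚ.≰⇒> k≰q) k≤B)) (zeroˡ _))
      ... | yes _   | inj₁ Πv≈0 = inj₁ (trans (*-congˡ Πv≈0) (zeroʳ _))
      ... | yes k≤q | inj₂ v≤q  = inj₂ (k≤q ∷ v≤q)

      tupleSum-supported : ∀ m → m ℕ.* q ℕ.≤ B → tupleSum f m B ≈ pow (Σlist (map f (upTo (suc B)))) m
      tupleSum-supported m m*q≤B =
        trans (Σ-map-filter _ (All.map vanish-unless-bounded (tuples-All≤ m B))) (Σ-tuples-Πvec m B)
        where
        vanish-unless-bounded : ∀ {v : Vec ℕ m} → VecAll.All (ℕ._≤ B) v → ¬ Vec.sum v ℕ.≤ B → Πvec f v ≈ 0#
        vanish-unless-bounded v≤B sum≰B with Πvec≈0⊎All≤ v≤B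
        ... | inj₁ Πv≈0 = Πv≈0
        ... | inj₂ v≤q  = contradiction (ℕₚ.≤-trans (All≤q⇒sum≤m*q v≤q) m*q≤B) sum≰B

open import Data.Nat using (_+_; _*_; _∸_; _≤_; _≥_; _≤?_)
open import Data.Nat.GCD using (gcd)
open import Data.Integer using (+_; _-_)
open import Data.Integer.Divisibility using (_∣_)
open CommutativeRing using (Carrier; _≈_; 0#)
open RingSums using (tupleSum; Σlist; pow)

lemma4p1 : ∀ {c ℓ : Level} (R : CommutativeRing c ℓ) →
    (d m n r : ℕ) → d ≥ 1 → m ≥ 1 → n ≥ 1 → r ≥ 1 →
    (+ d) ∣ ((+ n) - (+ r)) →
    gcd r d ≡ 1 →
    d ≥ m → m ≥ 2 →
    (λs : ℕ → Carrier R) →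
    (∀ k → n + d ≤ d * k + r → k ≤ n ∸ 1 → _≈_ R (λs k) (0# R)) →
    _≈_ R (tupleSum R λs m (n ∸ 1))
          (pow R (Σlist R (map λs (filter (λ k → d * k + r ≤? n) (upTo (suc n))))) m)
lemma4p1 R d m zero r _ _ () _ _ _ _ _ _ _
lemma4p1 R d m n@(suc n-1) r d≥1 _ _ r≥1 d∣n-r _ m≤d _ λs vanish = begin
  tupleSum R λs m n-1
    ≈⟨ tupleSum-supported λs vanish-above-q m m*q≤n-1 ⟩
  pow R (Σlist R (map λs (upTo n))) m
    ≈⟨ pow-cong m (Σ-map-filter-upTo admissible? n-inadmissible vanish-inadmissible) ⟨
  pow R (Σlist R (map λs (filter admissible? (upTo (suc n))))) m
    ∎
  where
  open TupleSums R
  open SetoidReasoning (CommutativeRing.setoid R)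
  instance
    d-nonZero : NonZero d
    d-nonZero = >-nonZero d≥1
  admissible? : Decidable (λ k → d * k + r ≤ n)
  admissible? k = d * k + r ≤? n
  q : ℕ
  q = (n ∸ r) ℕ./ d
  m*q≤n-1 : m * q ≤ n-1
  m*q≤n-1 = ℕₚ.≤-trans (m≤n⇒m*[o/n]≤o (n ∸ r) m≤d) (ℕₚ.∸-monoʳ-≤ n r≥1)
  vanish-inadmissible : ∀ {k} → k ℕ.< n → ¬ d * k + r ≤ n → _≈_ R (λs k) (0# R)
  vanish-inadmissible {k} k<n ¬adm =
    vanish k (∣n-r⇒n<d*k+r⇒n+d≤d*k+r k d∣n-r (ℕₚ.≰⇒> ¬adm)) (s≤s⁻¹ k<n)
  vanish-above-q : ∀ k → q ℕ.< k → k ≤ n-1 → _≈_ R (λs k) (0# R)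
  vanish-above-q k q<k k≤n-1 = vanish-inadmissible (ℕ.s≤s k≤n-1) λ adm →
    ℕₚ.<⇒≱ q<k (m*n≤o⇒n≤o/m (ℕₚ.m+n≤o⇒m≤o∸n (d * k) adm))
  n-inadmissible : ¬ d * n + r ≤ n
  n-inadmissible = ℕₚ.<⇒≱ (ℕₚ.≤-<-trans (ℕₚ.m≤n*m n d) (ℕₚ.m<m+n (d * n) r≥1))
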